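{- Let $k_1, k_2$ be positive integers and $u : \mathbb{Z}^{k_1} \to \mathbb{Z}^{k_2}$ a function. Then $u$ admits a moderation $v : \mathbb{Z}^{k_1} \to \mathbb{Z}^{k_2}$. Let $\mathcal{B}$ be a subset of $\mathbb{Z}^{k_1}$ admitting a minimal complement $M$ in $\mathbb{Z}^{k_1}$. Then the subset $M_v := \{(x, v(x)) : x \in M\}$ of $\mathbb{Z}^{k_1 + k_2}$ is a minimal complement in $\mathbb{Z}^{k_1+k_2}$ of every subset $X \subseteq \mathbb{Z}^{k_1+k_2}$ satisfying $$\mathcal{B} \times \mathbb{Z}^{k_2} \subseteq X \subseteq (\mathcal{B} \times \mathbb{Z}^{k_2}) \cup \bigcup_{x \in \mathbb{Z}^{k_1} \setminus \mathcal{B}} \big(\{x\} \times \mathbb{Z}^{k_2}_{<u(x)}\big).$$ Moreover, for each subgroup $G$ of finite index in $\mathbb{Z}^{k_2}$, the function $u$ has a moderation $v_G : \mathbb{Z}^{k_1} \to \mathbb{Z}^{k_2}$ taking values in $G$, and every subset $Y \subseteq \mathbb{Z}^{k_1+k_2}$ satisfying $$\mathcal{B} \times G \subseteq Y \subseteq (\mathcal{B} \times G) \cup \bigcup_{x \in \mathbb{Z}^{k_1} \setminus \mathcal{B}} \big(\{x\} \times \mathbb{Z}^{k_2}_{<u(x)}\big)$$ has the subset $M_{v_G} + C$ of $\mathbb{Z}^{k_1+k_2}$ as a minimal complement in $\mathbb{Z}^{k_1+k_2}$, where $M_{v_G} := \{(x, v_G(x)) : x \in M\}$ and $C$ is a set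 of coset representatives of $G$ in $\mathbb{Z}^{k_2}$ (viewed inside $\{0\} \times \mathbb{Z}^{k_2}$).
   Context: For an abelian group $H$ and nonempty subsets $W, W' \subseteq H$, $W'$ is a complement of $W$ in $H$ if $W + W' = H$; it is a minimal complement if moreover $W + (W' \setminus \{w'\}) \neq H$ for every $w' \in W'$. $\mathbb{Z}^{k_2}$ carries the lexicographic (dictionary) order induced by the order of $\mathbb{Z}$, and $\mathbb{Z}^{k_2}_{<a} = \{z \in \mathbb{Z}^{k_2} : z < a\}$. A function $v : \mathbb{Z}^{k_1} \to \mathbb{Z}^{k_2}$ is a moderation of $u$ if for each $x_0 \in \mathbb{Z}^{k_1}$ the function $x \mapsto v(x) + u(x_0 - x)$ on $\mathbb{Z}^{k_1}$ is bounded above in this lexicographic order. -}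

module Defs where

open import Data.Nat using (ℕ) renaming (_+_ to _+ℕ_)
open import Data.Integer as ℤ using (ℤ; 0ℤ)
open import Data.Vec using (Vec; []; _∷_; zipWith; map; replicate; _++_)
open import Data.List using (List)
open import Data.List.Relation.Unary.Any using (Any)
open import Data.Product using (Σ; ∃; ∃-syntax; _×_; _,_)
open import Data.Sum using (_⊎_)
open import Relation.Binary.PropositionalEquality using (_≡_; _≢_)
open import Relation.Nullary using (¬_)
open import Data.Empty using (⊥)

Zk : ℕ → Set
Zk k = Vec ℤ k

Subset : ℕ → Set₁
Subset k = Zk k → Set

_⊕_ : ∀ {k} → Zk k → Zk k → Zk k
_⊕_ = zipWith ℤ._+_

⊖_ : ∀ {k} → Zk k → Zk k
⊖_ = map (λ a → ℤ.- a)

_⊝_ : ∀ {k} → Zk k → Zk k → Zk k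
a ⊝ b = a ⊕ (⊖ b)

𝟘 : ∀ {k} → Zk k
𝟘 = replicate _ 0ℤ

infix 4 _<ₗ_ _≤ₗ_
_<ₗ_ : ∀ {k} → Zk k → Zk k → Set
[] <ₗ [] = ⊥
(a ∷ as) <ₗ (b ∷ bs) = (a ℤ.< b) ⊎ ((a ≡ b) × (as <ₗ bs))

_≤ₗ_ : ∀ {k} → Zk k → Zk k → Set
a ≤ₗ b = (a <ₗ b) ⊎ (a ≡ b)

_⊞_ : ∀ {k} → Subset k → Subset k → Subset k
(W ⊞ W') h = ∃[ w ] ∃[ w' ] (W w × W' w' × h ≡ w ⊕ w')

Nonempty : ∀ {k} → Subset k → Set
Nonempty W = ∃[ w ] W w

IsComplement : ∀ {k} → Subset k → Subset k → Set
IsComplement W W' = Nonempty W × Nonempty W' × (∀ h → (W ⊞ W') h)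

IsMinimalComplement : ∀ {k} → Subset k → Subset k → Set
IsMinimalComplement W W' =
  IsComplement W W' ×
  (∀ w' → W' w' → ¬ (∀ h → (W ⊞ (λ z → W' z × z ≢ w')) h))

IsModeration : ∀ {k₁ k₂} → (Zk k₁ → Zk k₂) → (Zk k₁ → Zk k₂) → Set
IsModeration {k₁} {k₂} v u =
  ∀ (x₀ : Zk k₁) → ∃[ b ] (∀ (x : Zk k₁) → (v x ⊕ u (x₀ ⊝ x)) ≤ₗ b)

record IsSubgroup {k : ℕ} (G : Subset k) : Set where
  field
    has-zero : G 𝟘
    closed-+ : ∀ {a b} → G a → G b → G (a ⊕ b)
    closed-neg : ∀ {a} → G a → G (⊖ a)

HasFiniteIndex : ∀ {k} → Subset k → Set
HasFiniteIndex {k} G = Σ (List (Zk k)) (λ L → ∀ (z : Zk k) → Any (λ c → G (z ⊝ c)) L)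

IsCosetReps : ∀ {k} → Subset k → Subset k → Set
IsCosetReps {k} G C =
  (∀ (z : Zk k) → ∃[ c ] (C c × G (z ⊝ c))) ×
  (∀ c c' → C c → C c' → G (c ⊝ c') → c ≡ c')

Graph : ∀ {k₁ k₂} → Subset k₁ → (Zk k₁ → Zk k₂) → Subset (k₁ +ℕ k₂)
Graph {k₁} M v p = ∃[ x ] (M x × p ≡ x ++ v x)

Embed₂ : ∀ {k₁ k₂} → Subset k₂ → Subset (k₁ +ℕ k₂)
Embed₂ {k₁} C p = ∃[ c ] (C c × p ≡ 𝟘 {k₁} ++ c)

module Submission where

-- Every argument only ever looks at the FIRST coordinate of
-- ℤ^k₂ (k₂ = suc k): a lexicographic inequality a ≤ₗ b forces hd a ≤ hd b,
-- and hd a < hd b forces a <ₗ b.  Hence v moderates u exactly when the first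
-- coordinate of v x + u (x₀ - x) is bounded above for each x₀ ("head-bounded").
--
--  * Existence: with R x := Σ_{y ∈ box of radius 2‖x‖} |hd (u y)| (a finite
--    sum), v x := (-R x, 0, …, 0) is head-bounded, since ‖x₀ - x‖ ≤ 2‖x‖ or
--    ≤ 2‖x₀‖.  Subtracting from v x a representative of its G-coset drawn from
--    the finite list witnessing finite index moves hd by a bounded amount, so
--    it keeps a moderation and makes it G-valued.
--  * Main theorem (the subgroup version): M_v + C covers by splitting the
--    second coordinate along G.  For minimality, if (m, v m + c) were
--    redundant, take any h and a point (h, w) with w ∈ c + G and hd w huge
--    (G is unbounded in hd, C is bounded in hd).  Its decomposition cannot use
--    a "low" fiber of Y (that would bound hd w via the moderation), so it uses
--    B × G; then the coset of w forces the representative c, and the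
--    M-component gives h ∈ B + (M ∖ {m}), contradicting minimality of M.
--  * The first version is the case G = ℤ^k₂, C = {0}.

open import Defs
open import Data.Nat using (ℕ; _<_) renaming (_+_ to _+ℕ_)
open import Data.Vec using (_++_)
open import Data.Product using (∃-syntax; _×_)
open import Data.Sum using (_⊎_)
open import Relation.Nullary using (¬_)

open import Data.Nat as ℕ using (zero; suc; z≤n; s≤s)
import Data.Nat.Properties as ℕP
open import Data.Nat.ListAction using (sum)
import Data.Nat.Tactic.RingSolver as ℕSolver
open import Data.Integer as ℤ using (ℤ; +_; -[1+_]; 0ℤ; ∣_∣; +≤+; -≤+)
import Data.Integer.Properties as ℤP
open import Data.Integer.Tactic.RingSolver using (solve-∀)
open import Data.Vec as Vec using (Vec; []; _∷_)
open import Data.Vec.Properties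
  using (zipWith-assoc; zipWith-comm; zipWith-identityʳ; zipWith-inverseʳ; zipWith-++; ++-injective)
open import Data.List as List using (List; []; _∷_; cartesianProductWith)
open import Data.List.Relation.Unary.Any using (here; there)
open import Data.List.Membership.Propositional using (_∈_; find)
open import Data.List.Membership.Propositional.Properties using (∈-cartesianProductWith⁺)
open import Data.Product using (_,_; proj₁; proj₂)
open import Data.Sum using (inj₁; inj₂; map₁)
open import Data.Unit using (⊤; tt)
open import Data.Empty using (⊥-elim)
open import Function using (case_of_)
open import Relation.Binary.PropositionalEquality

⊕-assoc : ∀ {k} (a b c : Zk k) → (a ⊕ b) ⊕ c ≡ a ⊕ (b ⊕ c)
⊕-assoc = zipWith-assoc ℤP.+-assoc

⊕-comm : ∀ {k} (a b : Zk k) → a ⊕ b ≡ b ⊕ a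
⊕-comm = zipWith-comm ℤP.+-comm

⊕-identityʳ : ∀ {k} (a : Zk k) → a ⊕ 𝟘 ≡ a
⊕-identityʳ = zipWith-identityʳ ℤP.+-identityʳ

⊝-self : ∀ {k} (a : Zk k) → a ⊝ a ≡ 𝟘
⊝-self = zipWith-inverseʳ ℤP.+-inverseʳ

⊕-⊝-cancel : ∀ {k} (a b : Zk k) → (a ⊕ b) ⊝ b ≡ a
⊕-⊝-cancel a b = begin
  (a ⊕ b) ⊝ b    ≡⟨ ⊕-assoc a b (⊖ b) ⟩
  a ⊕ (b ⊝ b)    ≡⟨ cong (a ⊕_) (⊝-self b) ⟩
  a ⊕ 𝟘          ≡⟨ ⊕-identityʳ a ⟩
  a              ∎
  where open ≡-Reasoning

⊝-⊕-cancel : ∀ {k} (a b : Zk k) → (a ⊝ b) ⊕ b ≡ a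
⊝-⊕-cancel a b = begin
  (a ⊝ b) ⊕ b      ≡⟨ ⊕-assoc a (⊖ b) b ⟩
  a ⊕ ((⊖ b) ⊕ b)  ≡⟨ cong (a ⊕_) (trans (⊕-comm (⊖ b) b) (⊝-self b)) ⟩
  a ⊕ 𝟘            ≡⟨ ⊕-identityʳ a ⟩
  a                ∎
  where open ≡-Reasoning

⊝⊝-⊕-cancel : ∀ {k} (a b c : Zk k) → ((a ⊝ b) ⊝ c) ⊕ (b ⊕ c) ≡ a
⊝⊝-⊕-cancel a b c = begin
  ((a ⊝ b) ⊝ c) ⊕ (b ⊕ c)  ≡⟨ cong (((a ⊝ b) ⊝ c) ⊕_) (⊕-comm b c) ⟩
  ((a ⊝ b) ⊝ c) ⊕ (c ⊕ b)  ≡⟨ sym (⊕-assoc ((a ⊝ b) ⊝ c) c b) ⟩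
  (((a ⊝ b) ⊝ c) ⊕ c) ⊕ b  ≡⟨ cong (_⊕ b) (⊝-⊕-cancel (a ⊝ b) c) ⟩
  (a ⊝ b) ⊕ b              ≡⟨ ⊝-⊕-cancel a b ⟩
  a                        ∎
  where open ≡-Reasoning

⊝-chain : ∀ {k} (a b c : Zk k) → (a ⊝ b) ⊕ (b ⊝ c) ≡ a ⊝ c
⊝-chain a b c = begin
  (a ⊝ b) ⊕ (b ⊕ (⊖ c))  ≡⟨ sym (⊕-assoc (a ⊝ b) b (⊖ c)) ⟩
  ((a ⊝ b) ⊕ b) ⊝ c      ≡⟨ cong (_⊝ c) (⊝-⊕-cancel a b) ⟩
  a ⊝ c                  ∎
  where open ≡-Reasoning

⊕-difference : ∀ {k} (g c g' c' : Zk k) → g ⊕ c ≡ g' ⊕ c' → c ⊝ c' ≡ g' ⊝ g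
⊕-difference g c g' c' e = begin
  c ⊝ c'                ≡⟨ cong (_⊝ c') (sym (trans (cong (_⊝ g) (⊕-comm g c)) (⊕-⊝-cancel c g))) ⟩
  ((g ⊕ c) ⊝ g) ⊝ c'    ≡⟨ cong (λ t → (t ⊝ g) ⊝ c') e ⟩
  ((g' ⊕ c') ⊝ g) ⊝ c'  ≡⟨ cong (_⊝ c') (⊕-assoc g' c' (⊖ g)) ⟩
  (g' ⊕ (c' ⊝ g)) ⊝ c'  ≡⟨ cong (λ t → (g' ⊕ t) ⊝ c') (⊕-comm c' (⊖ g)) ⟩
  (g' ⊕ ((⊖ g) ⊕ c')) ⊝ c' ≡⟨ cong (_⊝ c') (sym (⊕-assoc g' (⊖ g) c')) ⟩
  ((g' ⊝ g) ⊕ c') ⊝ c'  ≡⟨ ⊕-⊝-cancel (g' ⊝ g) c' ⟩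
  g' ⊝ g                ∎
  where open ≡-Reasoning

++-⊕ : ∀ {m n} (a c : Zk m) (b d : Zk n) → (a ++ b) ⊕ (c ++ d) ≡ (a ⊕ c) ++ (b ⊕ d)
++-⊕ a c b d = zipWith-++ ℤ._+_ a b c d

++-⊕-injective : ∀ {m n} {h x y : Zk m} {w z t : Zk n} →
                 h ++ w ≡ (x ++ z) ⊕ (y ++ t) → (h ≡ x ⊕ y) × (w ≡ z ⊕ t)
++-⊕-injective {h = h} {x} {y} {z = z} {t} e = ++-injective h (x ⊕ y) (trans e (++-⊕ x y z t))

hd : ∀ {k} → Zk (suc k) → ℤ
hd = Vec.head

hd-⊕ : ∀ {k} (a b : Zk (suc k)) → hd (a ⊕ b) ≡ hd a ℤ.+ hd b
hd-⊕ (x ∷ a) (y ∷ b) = refl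

hd-⊝ : ∀ {k} (a b : Zk (suc k)) → hd (a ⊝ b) ≡ hd a ℤ.- hd b
hd-⊝ (x ∷ a) (y ∷ b) = refl

<ₗ⇒hd≤ : ∀ {k} {a b : Zk (suc k)} → a <ₗ b → hd a ℤ.≤ hd b
<ₗ⇒hd≤ {a = x ∷ _} {y ∷ _} (inj₁ x<y)      = ℤP.<⇒≤ x<y
<ₗ⇒hd≤ {a = x ∷ _} {y ∷ _} (inj₂ (x≡y , _)) = ℤP.≤-reflexive x≡y

≤ₗ⇒hd≤ : ∀ {k} {a b : Zk (suc k)} → a ≤ₗ b → hd a ℤ.≤ hd b
≤ₗ⇒hd≤ (inj₁ a<b)  = <ₗ⇒hd≤ a<b
≤ₗ⇒hd≤ (inj₂ refl) = ℤP.≤-refl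

hd<⇒<ₗ : ∀ {k} {a b : Zk (suc k)} → hd a ℤ.< hd b → a <ₗ b
hd<⇒<ₗ {a = x ∷ _} {y ∷ _} x<y = inj₁ x<y

i≤∣i∣ : ∀ i → i ℤ.≤ + ∣ i ∣
i≤∣i∣ (+ n)    = ℤP.≤-refl
i≤∣i∣ -[1+ n ] = -≤+

HeadBounded : ∀ {k₁ k} → (Zk k₁ → Zk (suc k)) → (Zk k₁ → Zk (suc k)) → Set
HeadBounded v u = ∀ x₀ → ∃[ H ] (∀ x → hd (v x) ℤ.+ hd (u (x₀ ⊝ x)) ℤ.≤ H)

moderation⇒headBounded : ∀ {k₁ k} {v u : Zk k₁ → Zk (suc k)} →
                         IsModeration v u → HeadBounded v u
moderation⇒headBounded {v = v} {u} mod x₀ =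
  let b , bound = mod x₀ in
  hd b , λ x → subst (ℤ._≤ hd b) (hd-⊕ (v x) (u (x₀ ⊝ x))) (≤ₗ⇒hd≤ (bound x))

headBounded⇒moderation : ∀ {k₁ k} {v u : Zk k₁ → Zk (suc k)} →
                         HeadBounded v u → IsModeration v u
headBounded⇒moderation {v = v} {u} hb x₀ =
  let H , bound = hb x₀ in
  ℤ.suc H ∷ 𝟘 , λ x → inj₁ (hd<⇒<ₗ (ℤP.suc[i]≤j⇒i<j (ℤP.suc-mono
    (subst (ℤ._≤ H) (sym (hd-⊕ (v x) (u (x₀ ⊝ x)))) (bound x)))))

moderation-perturb : ∀ {k₁ k} {v v' u : Zk k₁ → Zk (suc k)} (K : ℤ) →
                     (∀ x → hd (v' x) ℤ.≤ hd (v x) ℤ.+ K) →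
                     IsModeration v u → IsModeration v' u
moderation-perturb {v = v} {v'} {u} K v'≤v+K mod = headBounded⇒moderation {v = v'} {u} λ x₀ →
  let H , bound = moderation⇒headBounded {v = v} {u} mod x₀ in
  H ℤ.+ K , λ x → begin
    hd (v' x) ℤ.+ hd (u (x₀ ⊝ x))          ≤⟨ ℤP.+-monoˡ-≤ (hd (u (x₀ ⊝ x))) (v'≤v+K x) ⟩
    (hd (v x) ℤ.+ K) ℤ.+ hd (u (x₀ ⊝ x))   ≡⟨ shuffle (hd (v x)) K (hd (u (x₀ ⊝ x))) ⟩
    (hd (v x) ℤ.+ hd (u (x₀ ⊝ x))) ℤ.+ K   ≤⟨ ℤP.+-monoˡ-≤ K (bound x) ⟩
    H ℤ.+ K                                ∎
  where
  open ℤP.≤-Reasoning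
  shuffle : ∀ a b c → (a ℤ.+ b) ℤ.+ c ≡ (a ℤ.+ c) ℤ.+ b
  shuffle = solve-∀

∈⇒≤sum : ∀ {A : Set} (f : A → ℕ) {a : A} {as : List A} → a ∈ as → f a ℕ.≤ sum (List.map f as)
∈⇒≤sum f (here refl) = ℕP.m≤m+n _ _
∈⇒≤sum f {as = b ∷ _} (there a∈as) = ℕP.≤-trans (∈⇒≤sum f a∈as) (ℕP.m≤n+m _ (f b))

∥_∥ : ∀ {k} → Zk k → ℕ
∥ [] ∥     = 0
∥ a ∷ as ∥ = ∣ a ∣ +ℕ ∥ as ∥

∥⊝∥≤ : ∀ {k} (a b : Zk k) → ∥ a ⊝ b ∥ ℕ.≤ ∥ a ∥ +ℕ ∥ b ∥
∥⊝∥≤ []      []      = z≤n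
∥⊝∥≤ (x ∷ a) (y ∷ b) = ℕP.≤-trans
  (ℕP.+-mono-≤ (ℤP.∣i-j∣≤∣i∣+∣j∣ x y) (∥⊝∥≤ a b))
  (ℕP.≤-reflexive (interchange ∣ x ∣ ∣ y ∣ ∥ a ∥ ∥ b ∥))
  where
  interchange : ∀ p q r s → (p +ℕ q) +ℕ (r +ℕ s) ≡ (p +ℕ r) +ℕ (q +ℕ s)
  interchange = ℕSolver.solve-∀

interval : ℕ → List ℤ
interval zero    = 0ℤ ∷ []
interval (suc n) = + suc n ∷ -[1+ n ] ∷ interval n

∈-interval : ∀ n i → ∣ i ∣ ℕ.≤ n → i ∈ interval n
∈-interval zero    (+ zero)  _ = here refl
∈-interval (suc n) (+ m)     m≤1+n with ℕP.m≤n⇒m<n∨m≡n m≤1+n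
... | inj₂ refl = here refl
... | inj₁ m<1+n = there (there (∈-interval n (+ m) (ℕP.≤-pred m<1+n)))
∈-interval (suc n) -[1+ m ]  (s≤s m≤n) with ℕP.m≤n⇒m<n∨m≡n m≤n
... | inj₂ refl = there (here refl)
... | inj₁ m<n  = there (there (∈-interval n -[1+ m ] m<n))

box : (k n : ℕ) → List (Zk k)
box zero    n = [] ∷ []
box (suc k) n = cartesianProductWith _∷_ (interval n) (box k n)

∈-box : ∀ k n (y : Zk k) → ∥ y ∥ ℕ.≤ n → y ∈ box k n
∈-box zero    n []       _ = here refl
∈-box (suc k) n (i ∷ ys) ∥y∥≤n = ∈-cartesianProductWith⁺ _∷_
  (∈-interval n i (ℕP.≤-trans (ℕP.m≤m+n ∣ i ∣ ∥ ys ∥) ∥y∥≤n))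
  (∈-box k n ys (ℕP.≤-trans (ℕP.m≤n+m ∥ ys ∥ ∣ i ∣) ∥y∥≤n))

ballBound : ∀ {k} → (Zk k → ℕ) → ℕ → ℕ
ballBound {k} f n = sum (List.map f (box k n))

ballBound-≥ : ∀ {k} (f : Zk k → ℕ) n y → ∥ y ∥ ℕ.≤ n → f y ℕ.≤ ballBound f n
ballBound-≥ {k} f n y ∥y∥≤n = ∈⇒≤sum f (∈-box k n y ∥y∥≤n)

moderation-exists : ∀ {k₁ k} (u : Zk k₁ → Zk (suc k)) → ∃[ v ] IsModeration v u
moderation-exists {k₁} {k} u = v , headBounded⇒moderation {v = v} {u} λ x₀ → + R x₀ , bounded x₀
  where
  size : Zk k₁ → ℕ
  size y = ∣ hd (u y) ∣

  R : Zk k₁ → ℕ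
  R x = ballBound size (∥ x ∥ +ℕ ∥ x ∥)

  v : Zk k₁ → Zk (suc k)
  v x = ℤ.- (+ R x) ∷ 𝟘

  -- ‖x₀ - x‖ ≤ 2‖x‖ or ≤ 2‖x₀‖, so one of R x, R x₀ dominates size (x₀ - x).
  size≤ : ∀ x₀ x → size (x₀ ⊝ x) ℕ.≤ R x +ℕ R x₀
  size≤ x₀ x with ℕP.≤-total ∥ x₀ ∥ ∥ x ∥
  ... | inj₁ ∥x₀∥≤∥x∥ = ℕP.≤-trans
          (ballBound-≥ size _ _ (ℕP.≤-trans (∥⊝∥≤ x₀ x) (ℕP.+-monoˡ-≤ ∥ x ∥ ∥x₀∥≤∥x∥)))
          (ℕP.m≤m+n _ _)
  ... | inj₂ ∥x∥≤∥x₀∥ = ℕP.≤-trans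
          (ballBound-≥ size _ _ (ℕP.≤-trans (∥⊝∥≤ x₀ x) (ℕP.+-monoʳ-≤ ∥ x₀ ∥ ∥x∥≤∥x₀∥)))
          (ℕP.m≤n+m _ _)

  bounded : ∀ x₀ x → ℤ.- (+ R x) ℤ.+ hd (u (x₀ ⊝ x)) ℤ.≤ + R x₀
  bounded x₀ x = begin
    ℤ.- (+ R x) ℤ.+ hd (u (x₀ ⊝ x))     ≤⟨ ℤP.+-monoʳ-≤ (ℤ.- (+ R x)) (i≤∣i∣ (hd (u (x₀ ⊝ x)))) ⟩
    ℤ.- (+ R x) ℤ.+ + size (x₀ ⊝ x)     ≤⟨ ℤP.+-monoʳ-≤ (ℤ.- (+ R x)) (+≤+ (size≤ x₀ x)) ⟩
    ℤ.- (+ R x) ℤ.+ + (R x +ℕ R x₀)     ≡⟨ cong (λ t → ℤ.- (+ R x) ℤ.+ t) (ℤP.pos-+ (R x) (R x₀)) ⟩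
    ℤ.- (+ R x) ℤ.+ (+ R x ℤ.+ + R x₀)  ≡⟨ neg-cancel (+ R x) (+ R x₀) ⟩
    + R x₀                              ∎
    where
    open ℤP.≤-Reasoning
    neg-cancel : ∀ a b → ℤ.- a ℤ.+ (a ℤ.+ b) ≡ b
    neg-cancel = solve-∀

small-representatives : ∀ {k} {G : Subset (suc k)} → HasFiniteIndex G →
                        ∃[ K ] (∀ z → ∃[ c ] (G (z ⊝ c) × ∣ hd c ∣ ℕ.≤ K))
small-representatives (Ls , covers) = sum (List.map size Ls) , λ z →
  let c , c∈Ls , Gz-c = find (covers z) in c , Gz-c , ∈⇒≤sum size c∈Ls
  where
  size : Zk _ → ℕ
  size c = ∣ hd c ∣

coset-unbounded : ∀ {k} {G : Subset (suc k)} → HasFiniteIndex G →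
                  ∀ c T → ∃[ g ] (G g × T ℤ.≤ hd (g ⊕ c))
coset-unbounded {G = G} fi c T =
  let K , represent = small-representatives {G = G} fi
      N = (T ℤ.- hd c) ℤ.+ + K
      z = N ∷ 𝟘
      r , Gz-r , ∣r∣≤K = represent z
      open ℤP.≤-Reasoning
  in z ⊝ r , Gz-r , (begin
       T                                      ≡⟨ rearrange T (hd c) (+ K) ⟩
       (N ℤ.- + K) ℤ.+ hd c                   ≤⟨ ℤP.+-monoˡ-≤ (hd c) (ℤP.+-monoʳ-≤ N
                                                    (ℤP.neg-mono-≤ (ℤP.≤-trans (i≤∣i∣ (hd r)) (+≤+ ∣r∣≤K)))) ⟩
       (N ℤ.- hd r) ℤ.+ hd c                  ≡⟨ sym (trans (hd-⊕ (z ⊝ r) c) (cong (ℤ._+ hd c) (hd-⊝ z r))) ⟩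
       hd ((z ⊝ r) ⊕ c)                       ∎)
  where
  rearrange : ∀ t a b → t ≡ (((t ℤ.- a) ℤ.+ b) ℤ.- b) ℤ.+ a
  rearrange = solve-∀

-- A set of coset representatives of a finite-index subgroup is bounded in
-- the first coordinate: each representative is the representative of the
-- coset of some element of the finite list.
cosetReps-bounded : ∀ {k} {G C : Subset (suc k)} → IsSubgroup G → HasFiniteIndex G →
                    IsCosetReps G C → ∃[ K ] (∀ c → C c → hd c ℤ.≤ + K)
cosetReps-bounded {G = G} sg (Ls , covers) (represent , unique) =
  sum (List.map size Ls) , λ c Cc →
    let l , l∈Ls , Gc-l = find (covers c)
        c≡rep = unique c (rep l) Cc (proj₁ (proj₂ (represent l)))
                  (subst G (⊝-chain c l (rep l)) (closed-+ Gc-l (proj₂ (proj₂ (represent l)))))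
    in ℤP.≤-trans (i≤∣i∣ (hd c))
         (+≤+ (subst (λ t → ∣ hd t ∣ ℕ.≤ _) (sym c≡rep) (∈⇒≤sum size l∈Ls)))
  where
  open IsSubgroup sg
  rep : Zk _ → Zk _
  rep z = proj₁ (represent z)
  size : Zk _ → ℕ
  size l = ∣ hd (rep l) ∣

cosetReps-unique : ∀ {k} {G C : Subset (suc k)} → IsSubgroup G → IsCosetReps G C →
                   ∀ {g c g' c'} → G g → G g' → C c → C c' → g ⊕ c ≡ g' ⊕ c' → c ≡ c'
cosetReps-unique {G = G} sg (_ , unique) {g} {c} {g'} {c'} Gg Gg' Cc Cc' e =
  unique c c' Cc Cc' (subst G (sym (⊕-difference g c g' c' e)) (closed-+ Gg' (closed-neg Gg)))
  where open IsSubgroup sg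

moderation-into-subgroup : ∀ {k₁ k} {u v : Zk k₁ → Zk (suc k)} {G : Subset (suc k)} →
                           HasFiniteIndex G → IsModeration v u →
                           ∃[ v' ] (IsModeration v' u × (∀ x → G (v' x)))
moderation-into-subgroup {u = u} {v} {G} fi mod =
  v' , moderation-perturb {v = v} {v'} {u} (+ K) v'≤v+K mod , λ x → proj₁ (proj₂ (represent (v x)))
  where
  K : ℕ
  K = proj₁ (small-representatives {G = G} fi)
  represent : ∀ z → ∃[ c ] (G (z ⊝ c) × ∣ hd c ∣ ℕ.≤ K)
  represent = proj₂ (small-representatives {G = G} fi)
  v' : Zk _ → Zk _
  v' x = v x ⊝ proj₁ (represent (v x))
  v'≤v+K : ∀ x → hd (v' x) ℤ.≤ hd (v x) ℤ.+ + K
  v'≤v+K x =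
    let c , _ , ∣c∣≤K = represent (v x) in
    subst (ℤ._≤ hd (v x) ℤ.+ + K) (sym (hd-⊝ (v x) c))
      (ℤP.+-monoʳ-≤ (hd (v x)) (ℤP.≤-trans (i≤∣i∣ (ℤ.- hd c))
        (+≤+ (subst (ℕ._≤ K) (sym (ℤP.∣-i∣≡∣i∣ (hd c))) ∣c∣≤K))))

shiftedGraph-point : ∀ {k₁ k₂} (v : Zk k₁ → Zk k₂) (m : Zk k₁) (c : Zk k₂) →
                     (m ++ v m) ⊕ (𝟘 {k₁} ++ c) ≡ m ++ (v m ⊕ c)
shiftedGraph-point v m c = trans (++-⊕ m 𝟘 (v m) c) (cong (_++ (v m ⊕ c)) (⊕-identityʳ m))

shiftedGraph⁺ : ∀ {k₁ k₂} {M : Subset k₁} {v : Zk k₁ → Zk k₂} {C : Subset k₂} {m c} →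
                M m → C c → (Graph M v ⊞ Embed₂ {k₁} C) (m ++ (v m ⊕ c))
shiftedGraph⁺ {v = v} {m = m} {c} Mm Cc =
  m ++ v m , 𝟘 ++ c , (m , Mm , refl) , (c , Cc , refl) , sym (shiftedGraph-point v m c)

shiftedGraph⁻ : ∀ {k₁ k₂} {M : Subset k₁} {v : Zk k₁ → Zk k₂} {C : Subset k₂} {p} →
                (Graph M v ⊞ Embed₂ {k₁} C) p → ∃[ m ] ∃[ c ] (M m × C c × p ≡ m ++ (v m ⊕ c))
shiftedGraph⁻ {v = v} (_ , _ , (m , Mm , refl) , (c , Cc , refl) , refl) =
  m , c , Mm , Cc , shiftedGraph-point v m c

module ShiftedGraphComplement
  {k₁ k : ℕ} (u v : Zk k₁ → Zk (suc k)) (mod : IsModeration v u)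
  (G : Subset (suc k)) (sg : IsSubgroup G) (fi : HasFiniteIndex G) (v∈G : ∀ x → G (v x))
  (B M : Subset k₁) (Y : Subset (k₁ +ℕ suc k))
  (B×G⊆Y : ∀ x z → B x → G z → Y (x ++ z))
  (Y-fibers : ∀ x z → Y (x ++ z) → (B x × G z) ⊎ (¬ B x × z <ₗ u x))
  (C : Subset (suc k)) (reps : IsCosetReps G C)
  where

  open IsSubgroup sg

  S : Subset (k₁ +ℕ suc k)
  S = Graph M v ⊞ Embed₂ {k₁} C

  covering : (∀ h → (B ⊞ M) h) → ∀ p → (Y ⊞ S) p
  covering covers p =
    let h , w , p≡h++w = Vec.splitAt k₁ p
        b , m , Bb , Mm , h≡b+m = covers h
        c , Cc , Gg = proj₁ reps (w ⊝ v m)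
        g = (w ⊝ v m) ⊝ c
        open ≡-Reasoning
    in b ++ g , m ++ (v m ⊕ c) , B×G⊆Y b g Bb Gg , shiftedGraph⁺ Mm Cc , (begin
         p                             ≡⟨ p≡h++w ⟩
         h ++ w                        ≡⟨ cong₂ _++_ h≡b+m (sym (⊝⊝-⊕-cancel w (v m) c)) ⟩
         (b ⊕ m) ++ (g ⊕ (v m ⊕ c))    ≡⟨ sym (++-⊕ b m g (v m ⊕ c)) ⟩
         (b ++ g) ⊕ (m ++ (v m ⊕ c))   ∎)

  low-fiber-bound : ∀ {h H K} → (∀ x → hd (v x) ℤ.+ hd (u (h ⊝ x)) ℤ.≤ H) →
                    (∀ c → C c → hd c ℤ.≤ + K) →
                    ∀ {x z m' c' w} → h ≡ x ⊕ m' → w ≡ z ⊕ (v m' ⊕ c') → C c' → z <ₗ u x →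
                    hd w ℤ.≤ H ℤ.+ + K
  low-fiber-bound {h} {H} {K} bound C≤K {x} {z} {m'} {c'} {w} h≡x+m' w≡z+vm'+c' Cc' z<ux = begin
    hd w                                         ≡⟨ cong hd w≡z+vm'+c' ⟩
    hd (z ⊕ (v m' ⊕ c'))                         ≡⟨ trans (hd-⊕ z _) (cong (λ t → hd z ℤ.+ t) (hd-⊕ (v m') c')) ⟩
    hd z ℤ.+ (hd (v m') ℤ.+ hd c')               ≤⟨ ℤP.+-mono-≤ hd-z≤ (ℤP.+-monoʳ-≤ (hd (v m')) (C≤K c' Cc')) ⟩
    hd (u (h ⊝ m')) ℤ.+ (hd (v m') ℤ.+ + K)       ≡⟨ rearrange (hd (u (h ⊝ m'))) (hd (v m')) (+ K) ⟩
    (hd (v m') ℤ.+ hd (u (h ⊝ m'))) ℤ.+ + K       ≤⟨ ℤP.+-monoˡ-≤ (+ K) (bound m') ⟩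
    H ℤ.+ + K                                    ∎
    where
    open ℤP.≤-Reasoning
    x≡h-m' : x ≡ h ⊝ m'
    x≡h-m' = trans (sym (⊕-⊝-cancel x m')) (cong (_⊝ m') (sym h≡x+m'))
    hd-z≤ : hd z ℤ.≤ hd (u (h ⊝ m'))
    hd-z≤ = subst (λ t → hd z ℤ.≤ hd (u t)) x≡h-m' (<ₗ⇒hd≤ z<ux)
    rearrange : ∀ a b c → a ℤ.+ (b ℤ.+ c) ≡ (b ℤ.+ a) ℤ.+ c
    rearrange = solve-∀

  -- If the point (m, v m + c) of S were redundant, then m would be redundant in M:
  -- cover (h, w) with w ∈ c + G of first coordinate beyond H + K.  The low
  -- fibers cannot reach (h, w), so it is (x, z) + (m', v m' + c') with x ∈ B,
  -- z ∈ G; then c' ≡ c by the coset of w, hence m' ≢ m and h = x + m'.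
  redundant-point⇒redundant-m :
    ∀ {m c} → M m → C c → (∀ p → (Y ⊞ (λ s → S s × s ≢ m ++ (v m ⊕ c))) p) →
    ∀ h → (B ⊞ (λ x → M x × x ≢ m)) h
  redundant-point⇒redundant-m {m} {c} Mm Cc covers h =
    let H , bound = moderation⇒headBounded {v = v} {u} mod h
        K , C≤K = cosetReps-bounded sg fi reps
        g , Gg , high = coset-unbounded {G = G} fi c (ℤ.suc (H ℤ.+ + K))
        y , s , Yy , (Ss , s≢) , h++w≡y+s = covers (h ++ (g ⊕ c))
        x , z , y≡x++z = Vec.splitAt k₁ y
        m' , c' , Mm' , Cc' , s≡ = shiftedGraph⁻ Ss
        h≡x+m' , w≡z+vm'+c' = ++-⊕-injective (trans h++w≡y+s (cong₂ _⊕_ y≡x++z s≡))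
    in case Y-fibers x z (subst Y y≡x++z Yy) of λ where
      (inj₂ (_ , z<ux)) → ⊥-elim (ℤP.<⇒≱ (ℤP.suc[i]≤j⇒i<j high)
                            (low-fiber-bound bound C≤K h≡x+m' w≡z+vm'+c' Cc' z<ux))
      (inj₁ (Bx , Gz)) →
        let c≡c' = cosetReps-unique sg reps Gg (closed-+ Gz (v∈G m')) Cc Cc'
                     (trans w≡z+vm'+c' (sym (⊕-assoc z (v m') c')))
        in x , m' , Bx ,
           (Mm' , λ m'≡m → s≢ (trans s≡ (cong₂ (λ t t' → t ++ (v t ⊕ t')) m'≡m (sym c≡c')))) ,
           h≡x+m'

  minimal : (∀ m → M m → ¬ (∀ h → (B ⊞ (λ x → M x × x ≢ m)) h)) →
            ∀ s → S s → ¬ (∀ p → (Y ⊞ (λ t → S t × t ≢ s)) p)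
  minimal M-minimal s Ss covers with shiftedGraph⁻ Ss
  ... | m , c , Mm , Cc , refl = M-minimal m Mm (redundant-point⇒redundant-m Mm Cc covers)

  shiftedGraph-minimalComplement : IsMinimalComplement B M → IsMinimalComplement Y S
  shiftedGraph-minimalComplement (((b , Bb) , (m , Mm) , covers) , M-minimal) =
    let c , Cc , _ = proj₁ reps 𝟘 in
    ((b ++ 𝟘 , B×G⊆Y b 𝟘 Bb has-zero) , (m ++ (v m ⊕ c) , shiftedGraph⁺ Mm Cc) , covering covers) ,
    minimal M-minimal

minimalComplement-resp : ∀ {k} {W S T : Subset k} → (∀ p → S p → T p) → (∀ p → T p → S p) →
                         IsMinimalComplement W S → IsMinimalComplement W T
minimalComplement-resp S⊆T T⊆S ((nonempty-W , (s , Ss) , covers) , S-minimal) =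
  (nonempty-W , (s , S⊆T s Ss) , λ h →
     let w , t , Ww , St , h≡w+t = covers h in w , t , Ww , S⊆T t St , h≡w+t) ,
  λ t Tt T-covers → S-minimal t (T⊆S t Tt) λ h →
     let w , r , Ww , (Tr , r≢t) , h≡w+r = T-covers h in w , r , Ww , (T⊆S r Tr , r≢t) , h≡w+r

whole : ∀ {k} → Subset k
whole _ = ⊤

whole-subgroup : ∀ {k} → IsSubgroup (whole {k})
whole-subgroup = record { has-zero = tt ; closed-+ = λ _ _ → tt ; closed-neg = λ _ → tt }

whole-finiteIndex : ∀ {k} → HasFiniteIndex (whole {k})
whole-finiteIndex = 𝟘 ∷ [] , λ _ → here tt

zero-cosetReps : ∀ {k} → IsCosetReps (whole {k}) (_≡ 𝟘)
zero-cosetReps = (λ _ → 𝟘 , refl , tt) , λ c c' c≡0 c'≡0 _ → trans c≡0 (sym c'≡0)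

-- The case G = ℤ^k₂, C = {0} of the main theorem: M_v itself is a minimal
-- complement of X, as M_v + {0} and M_v are the same set.
graph-minimalComplement :
  ∀ {k₁ k} (u v : Zk k₁ → Zk (suc k)) → IsModeration v u →
  ∀ (B M : Subset k₁) → IsMinimalComplement B M →
  ∀ (X : Subset (k₁ +ℕ suc k)) →
  (∀ x z → B x → X (x ++ z)) →
  (∀ x z → X (x ++ z) → B x ⊎ (¬ B x × z <ₗ u x)) →
  IsMinimalComplement X (Graph M v)
graph-minimalComplement {k₁} u v mod B M M-minimal X B×Z⊆X X-fibers =
  minimalComplement-resp shifted⊆graph graph⊆shifted
    (ShiftedGraphComplement.shiftedGraph-minimalComplement u v mod
       whole whole-subgroup whole-finiteIndex (λ _ → tt) B M X
       (λ x z Bx _ → B×Z⊆X x z Bx) (λ x z Xxz → map₁ (_, tt) (X-fibers x z Xxz))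
       (_≡ 𝟘) zero-cosetReps M-minimal)
  where
  shifted⊆graph : ∀ p → (Graph M v ⊞ Embed₂ {k₁} (_≡ 𝟘)) p → Graph M v p
  shifted⊆graph p q with shiftedGraph⁻ q
  ... | m , _ , Mm , refl , p≡ = m , Mm , trans p≡ (cong (m ++_) (⊕-identityʳ (v m)))

  graph⊆shifted : ∀ p → Graph M v p → (Graph M v ⊞ Embed₂ {k₁} (_≡ 𝟘)) p
  graph⊆shifted _ (m , Mm , refl) =
    subst (Graph M v ⊞ Embed₂ {k₁} (_≡ 𝟘)) (cong (m ++_) (⊕-identityʳ (v m))) (shiftedGraph⁺ Mm refl)

corollary5p9 : (k₁ k₂ : ℕ) → 0 < k₁ → 0 < k₂ → (u : Zk k₁ → Zk k₂) →
    (∃[ v ] IsModeration v u)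
  × (∀ (v : Zk k₁ → Zk k₂) → IsModeration v u →
       ∀ (B M : Subset k₁) → IsMinimalComplement B M →
       ∀ (X : Subset (k₁ +ℕ k₂)) →
       (∀ x z → B x → X (x ++ z)) →
       (∀ x z → X (x ++ z) → B x ⊎ (¬ B x × z <ₗ u x)) →
       IsMinimalComplement X (Graph M v))
  × (∀ (G : Subset k₂) → IsSubgroup G → HasFiniteIndex G →
         (∃[ v ] (IsModeration v u × (∀ x → G (v x))))
       × (∀ (v : Zk k₁ → Zk k₂) → IsModeration v u → (∀ x → G (v x)) →
            ∀ (B M : Subset k₁) → IsMinimalComplement B M →
            ∀ (Y : Subset (k₁ +ℕ k₂)) →
            (∀ x z → B x → G z → Y (x ++ z)) →
            (∀ x z → Y (x ++ z) → (B x × G z) ⊎ (¬ B x × z <ₗ u x)) →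
            ∀ (C : Subset k₂) → IsCosetReps G C →
            IsMinimalComplement Y (Graph M v ⊞ Embed₂ {k₁} C)))
corollary5p9 _ zero _ () _
corollary5p9 k₁ (suc k) _ _ u =
  moderation-exists u ,
  graph-minimalComplement u ,
  λ G G-subgroup G-finiteIndex →
    moderation-into-subgroup {u = u} {G = G} G-finiteIndex (proj₂ (moderation-exists u)) ,
    λ v mod v∈G B M M-minimal Y B×G⊆Y Y-fibers C reps →
      ShiftedGraphComplement.shiftedGraph-minimalComplement
        u v mod G G-subgroup G-finiteIndex v∈G B M Y B×G⊆Y Y-fibers C reps M-minimal
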